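{- Let $T$ be a rooted tree. The coheight profile profile $\mathbf{x}_{\mathbf{x}_h}=\prod_{v\in V(T)}x_{\mathbf{x}_h|_v}$ of $T$ can be reconstructed from the sampling function $F_T$; that is, if $T,T'$ are rooted trees with $F_T=F_{T'}$, then $\mathbf{x}_{\mathbf{x}_h}(T)=\mathbf{x}_{\mathbf{x}_h}(T')$.
   Context: $T$ is a finite rooted tree with root $v_T$; $h_v$ is the coheight of $v$ (length of the path from $v_T$ to $v$); $S_v$ is the subtree of $v$ and its descendants. $\mathbf{x}_h|_v=\prod_{u\in V(S_v)}x_{h_u}$ is the coheight profile of $v$ (a monomial in $x_0,x_1,\dots$). The coheight profile profile is the formal product $\prod_{v\in V(T)}x_{\mathbf{x}_h|_v}$ in indeterminates indexed by monomials. A coloring $f\colon V(T)\to\mathbb{Z}^+$ is increasing if $f(u)<f(v)$ whenever $u$ is the parent of $v$; $\Gamma^<(T;\mathbf{x})=\sum_{f\text{ increasing}}\prod_v x_{f(v)}$. Monomials are ordered lexicographically by exponent tuples (larger exponent at the first differing index means larger). For $n\in\mathbb{N}$, $\left[\prod_{i\le n}x_i^{e_i}\right]p$ is the sum of terms of $p$ whose exponent of $x_i$ equals $e_i$ for all $i\le n$. The sampling function is $F_T\left(\prod_{i\le n}x_i^{e_i}\right)=\max\left(\left[\prod_{i\le n}x_i^{e_i}\right]\Gamma^<(T;\mathbf{x})\right)$ (greatest such monomial, or $\varnothing$ if none). -}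

module Defs where

open import Data.Nat using (ℕ; zero; suc; _<_; _≤_; _+_)
open import Data.List using (List; []; _∷_; _++_)
open import Data.List.Relation.Unary.All using (All)
open import Data.Product using (Σ; _×_; _,_; ∃)
open import Data.Sum using (_⊎_)
open import Relation.Binary.PropositionalEquality using (_≡_)
import Data.List.Relation.Binary.Permutation.Propositional as PermP
import Data.List.Relation.Binary.Permutation.Setoid as PermS
open import Function.Bundles using (_⇔_)

-- Finite rooted trees (children listed in some order; all notions below
-- are invariant under reordering children).

data Tree : Set where
  node : List Tree → Tree

-- Coheight profiles.
-- depths d t : the multiset (as a list) of coheights of all vertices of
-- the subtree t, whose root has coheight d in the whole tree.

mutual
  depths : ℕ → Tree → List ℕ
  depths d (node ts) = d ∷ depthsL (suc d) ts

  depthsL : ℕ → List Tree → List ℕ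
  depthsL d []       = []
  depthsL d (t ∷ ts) = depths d t ++ depthsL d ts

-- A monomial  x_h|_v = ∏_{u ∈ S_v} x_{h_u}  is represented by the list of
-- the coheights h_u (u ∈ S_v), i.e. the multiset of variable indices,
-- taken up to permutation.
-- profiles d t : list of the coheight profiles x_h|_v of all vertices v of t.

mutual
  profiles : ℕ → Tree → List (List ℕ)
  profiles d (node ts) = depths d (node ts) ∷ profilesL (suc d) ts

  profilesL : ℕ → List Tree → List (List ℕ)
  profilesL d []       = []
  profilesL d (t ∷ ts) = profiles d t ++ profilesL d ts

profileProfile : Tree → List (List ℕ)
profileProfile T = profiles 0 T

-- Equality of coheight profile profiles: equality of multisets of
-- monomials, where monomials are themselves multisets of indices.
module MonPerm = PermS (PermP.↭-setoid {A = ℕ})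

_≋_ : List (List ℕ) → List (List ℕ) → Set
P ≋ Q = MonPerm._↭_ P Q

-- Colorings: a labelled tree of the same shape as T.

data LTree : Set where
  lnode : ℕ → List LTree → LTree

mutual
  shape : LTree → Tree
  shape (lnode _ ls) = node (shapeL ls)

  shapeL : List LTree → List Tree
  shapeL []       = []
  shapeL (l ∷ ls) = shape l ∷ shapeL ls

-- IncFrom b L : every label of L is > the label of its parent, and the root
-- label is > b.  With b = 0 this says: colors are positive integers and
-- the coloring is increasing.
data IncFrom : ℕ → LTree → Set where
  inc : ∀ {b c ls} → b < c → All (IncFrom c) ls → IncFrom b (lnode c ls)

record IncColoring (T : Tree) : Set where
  constructor coloring
  field
    labels     : LTree
    hasShape   : shape labels ≡ T
    increasing : IncFrom 0 labels

-- Exponent of x_i in the monomial ∏_v x_{f(v)}.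
mutual
  cnt : ℕ → LTree → ℕ
  cnt i (lnode c ls) = bump i c (cntL i ls)

  cntL : ℕ → List LTree → ℕ
  cntL i []       = 0
  cntL i (l ∷ ls) = cnt i l + cntL i ls

  bump : ℕ → ℕ → ℕ → ℕ
  bump zero    zero    k = suc k
  bump zero    (suc _) k = k
  bump (suc _) zero    k = k
  bump (suc i) (suc c) k = bump i c k

Monomial : Set
Monomial = ℕ → ℕ

colMon : {T : Tree} → IncColoring T → Monomial
colMon f i = cnt i (IncColoring.labels f)

-- m occurs (with nonzero coefficient) in Γ^<(T; x).
InGamma : Tree → Monomial → Set
InGamma T m = Σ (IncColoring T) λ f → ∀ i → colMon f i ≡ m i

LexLt : Monomial → Monomial → Set
LexLt m' m = ∃ λ k → (∀ i → i < k → m' i ≡ m i) × (m' k < m k)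

LexLe : Monomial → Monomial → Set
LexLe m' m = (∀ i → m' i ≡ m i) ⊎ LexLt m' m

Prefix : ℕ → Monomial → Monomial → Set
Prefix n e m = ∀ i → i ≤ n → m i ≡ e i

-- F_T(∏_{i≤n} x_i^{e_i}) = m : m is the greatest monomial of
-- [∏_{i≤n} x_i^{e_i}] Γ^<(T; x).  (F_T(...) = ∅ iff no m satisfies this.)
SamplesTo : Tree → ℕ → Monomial → Monomial → Set
SamplesTo T n e m =
  InGamma T m × Prefix n e m ×
  (∀ m' → InGamma T m' → Prefix n e m' → LexLe m' m)

SameSampling : Tree → Tree → Set
SameSampling T T' = ∀ n e m → SamplesTo T n e m ⇔ SamplesTo T' n e m

-- F_T at the empty prefix is the depth monomial (every vertex colored 1 + its coheight),
-- so F_T counts the vertices at each coheight. Prescribing all exponents up to x_(d+1),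
-- with k fewer factors x_(d+1), the greatest monomial comes from raising by one the
-- subtrees of k vertices at coheight d, and it is greatest exactly when the product of
-- the coheight profiles of these k vertices is lex-least. So F_T determines, for every
-- coheight d and every k, the lex-least product of k profiles at coheight d; these
-- minima recover the multiset of profiles at coheight d greedily, one smallest profile
-- at a time, and the profile profile is the union of these multisets over d.
module Submission where

open import Defs
open import Data.Nat
open import Data.Nat.Properties
open import Data.Nat.ListAction using (sum)
open import Data.Bool using (Bool; true; false)
open import Data.List.Relation.Unary.All using (All; []; _∷_)
open import Data.List using (List; []; _∷_; _++_; length; map)
open import Data.List.Properties using (++-assoc; ++-identityʳ; map-++; length-++)
open import Data.Product using (∃; ∃₂; _×_; _,_)
open import Data.Sum using (_⊎_; inj₁; inj₂)
open import Data.Empty using (⊥-elim)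
open import Function using (_∘_)
open import Function.Bundles using (Equivalence)
open import Relation.Nullary using (¬_; yes; no)
open import Relation.Binary.Definitions using (tri<; tri≈; tri>)
open import Relation.Binary.PropositionalEquality
open import Algebra.Properties.CommutativeSemigroup +-commutativeSemigroup using (interchange)
open import Data.List.Relation.Binary.Permutation.Propositional as Perm
  using (_↭_; ↭-refl; ↭-sym; ↭-trans; ↭-reflexive)
import Data.List.Relation.Binary.Permutation.Propositional.Properties as ↭
import Data.List.Relation.Binary.Permutation.Setoid.Properties as SetoidPerm

private
  variable
    i c k : ℕ
    a a' b b' w : Monomial
    x y xs ys zs S : List ℕ
    X Y : List (List ℕ)

bump-+ : ∀ i c k m → bump i c (k + m) ≡ bump i c k + m
bump-+ zero    zero    k m = refl
bump-+ zero    (suc c) k m = refl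
bump-+ (suc i) zero    k m = refl
bump-+ (suc i) (suc c) k m = bump-+ i c k m

bump-≢ : ∀ k → i ≢ c → bump i c k ≡ k
bump-≢ {zero}  {zero}  k i≢c = ⊥-elim (i≢c refl)
bump-≢ {zero}  {suc c} k i≢c = refl
bump-≢ {suc i} {zero}  k i≢c = refl
bump-≢ {suc i} {suc c} k i≢c = bump-≢ k (i≢c ∘ cong suc)

bump-≡ : ∀ i k → bump i i k ≡ suc k
bump-≡ zero    k = refl
bump-≡ (suc i) k = bump-≡ i k

bump-comm : ∀ i c c' k → bump i c (bump i c' k) ≡ bump i c' (bump i c k)
bump-comm zero    zero    zero     k = refl
bump-comm zero    zero    (suc c') k = refl
bump-comm zero    (suc c) zero     k = refl
bump-comm zero    (suc c) (suc c') k = refl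
bump-comm (suc i) zero    c'       k = refl
bump-comm (suc i) (suc c) zero     k = refl
bump-comm (suc i) (suc c) (suc c') k = bump-comm i c c' k

bump-injective : ∀ i c {k m} → bump i c k ≡ bump i c m → k ≡ m
bump-injective i c {k} {m} eq =
  +-cancelˡ-≡ (bump i c 0) k m (trans (sym (bump-+ i c 0 k)) (trans eq (bump-+ i c 0 m)))

exponents : List ℕ → Monomial
exponents []       i = 0
exponents (c ∷ cs) i = bump i c (exponents cs i)

exponents-++ : ∀ xs ys i → exponents (xs ++ ys) i ≡ exponents xs i + exponents ys i
exponents-++ []       ys i = refl
exponents-++ (c ∷ xs) ys i =
  trans (cong (bump i c) (exponents-++ xs ys i)) (bump-+ i c (exponents xs i) (exponents ys i))

exponents-↭ : xs ↭ ys → exponents xs ≗ exponents ys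
exponents-↭ Perm.refl          i = refl
exponents-↭ (Perm.prep c p)    i = cong (bump i c) (exponents-↭ p i)
exponents-↭ (Perm.swap c c' p) i =
  trans (bump-comm i c c' _) (cong (bump i c' ∘ bump i c) (exponents-↭ p i))
exponents-↭ (Perm.trans p q)   i = trans (exponents-↭ p i) (exponents-↭ q i)

exponents-vanish : ∀ xs → sum xs < i → exponents xs i ≡ 0
exponents-vanish []       _ = refl
exponents-vanish {i} (c ∷ xs) lt =
  trans (bump-≢ _ (λ i≡c → <-irrefl (sym i≡c) (≤-<-trans (m≤m+n c (sum xs)) lt)))
        (exponents-vanish xs (≤-<-trans (m≤n+m (sum xs) c) lt))

occurrence-split : ∀ c ys → 0 < exponents ys c → ∃₂ λ as bs → ys ≡ as ++ c ∷ bs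
occurrence-split c (d ∷ ys) p with c ≟ d
... | yes refl = [] , ys , refl
... | no c≢d with occurrence-split c ys (subst (0 <_) (bump-≢ _ c≢d) p)
...   | as , bs , refl = d ∷ as , bs , refl

exponents-injective : ∀ xs ys → exponents xs ≗ exponents ys → xs ↭ ys
exponents-injective []       []       _  = ↭-refl
exponents-injective []       (d ∷ ys) eq with trans (eq d) (bump-≡ d _)
... | ()
exponents-injective (c ∷ xs) ys eq
  with occurrence-split c ys (subst (0 <_) (trans (sym (bump-≡ c (exponents xs c))) (eq c)) z<s)
... | as , bs , refl =
  ↭-trans (Perm.prep c (exponents-injective xs (as ++ bs) rest)) (↭-sym (↭.shift c as bs))
  where
  rest : exponents xs ≗ exponents (as ++ bs)
  rest i = bump-injective i c (trans (eq i) (exponents-↭ (↭.shift c as bs) i))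

infix 4 _<ₗ_ _≤ₗ_

_<ₗ_ _≤ₗ_ : Monomial → Monomial → Set
_<ₗ_ = LexLt
_≤ₗ_ = LexLe

<ₗ-irrefl : ¬ a <ₗ a
<ₗ-irrefl (k , _ , lt) = <-irrefl refl lt

<ₗ-resp-≗ : a ≗ a' → b ≗ b' → a <ₗ b → a' <ₗ b'
<ₗ-resp-≗ a≗a' b≗b' (k , eq , lt) =
  k , (λ i i<k → trans (sym (a≗a' i)) (trans (eq i i<k) (b≗b' i))) , subst₂ _<_ (a≗a' k) (b≗b' k) lt

≤ₗ-resp-≗ : a ≗ a' → b ≗ b' → a ≤ₗ b → a' ≤ₗ b'
≤ₗ-resp-≗ a≗a' b≗b' (inj₁ a≗b) = inj₁ (λ i → trans (sym (a≗a' i)) (trans (a≗b i) (b≗b' i)))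
≤ₗ-resp-≗ a≗a' b≗b' (inj₂ a<b) = inj₂ (<ₗ-resp-≗ a≗a' b≗b' a<b)

<ₗ-trans : a <ₗ b → b <ₗ w → a <ₗ w
<ₗ-trans {a} {b} {w} (k , eq , lt) (k' , eq' , lt') with <-cmp k k'
... | tri< k<k' _ _ = k , (λ i i<k → trans (eq i i<k) (eq' i (<-trans i<k k<k'))) , subst (a k <_) (eq' k k<k') lt
... | tri≈ _ refl _ = k , (λ i i<k → trans (eq i i<k) (eq' i i<k)) , <-trans lt lt'
... | tri> _ _ k'<k = k' , (λ i i<k' → trans (eq i (<-trans i<k' k'<k)) (eq' i i<k')) , subst (_< w k') (sym (eq k' k'<k)) lt'

≤ₗ-refl : a ≤ₗ a
≤ₗ-refl = inj₁ (λ _ → refl)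

≤ₗ-trans : a ≤ₗ b → b ≤ₗ w → a ≤ₗ w
≤ₗ-trans (inj₁ a≗b) b≤w       = ≤ₗ-resp-≗ (sym ∘ a≗b) (λ _ → refl) b≤w
≤ₗ-trans (inj₂ a<b) (inj₁ b≗w) = inj₂ (<ₗ-resp-≗ (λ _ → refl) b≗w a<b)
≤ₗ-trans (inj₂ a<b) (inj₂ b<w) = inj₂ (<ₗ-trans a<b b<w)

<ₗ⇒≱ₗ : a <ₗ b → ¬ b ≤ₗ a
<ₗ⇒≱ₗ a<b (inj₁ b≗a) = <ₗ-irrefl (<ₗ-resp-≗ (λ _ → refl) b≗a a<b)
<ₗ⇒≱ₗ a<b (inj₂ b<a) = <ₗ-irrefl (<ₗ-trans a<b b<a)

≤ₗ-antisym : a ≤ₗ b → b ≤ₗ a → a ≗ b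
≤ₗ-antisym (inj₁ a≗b) _   = a≗b
≤ₗ-antisym (inj₂ a<b) b≤a = ⊥-elim (<ₗ⇒≱ₗ a<b b≤a)

infixl 6 _⊕_

_⊕_ : Monomial → Monomial → Monomial
(a ⊕ b) i = a i + b i

⊕-monoʳ-≤ₗ : ∀ w → a ≤ₗ b → w ⊕ a ≤ₗ w ⊕ b
⊕-monoʳ-≤ₗ w (inj₁ a≗b)            = inj₁ (λ i → cong (w i +_) (a≗b i))
⊕-monoʳ-≤ₗ w (inj₂ (k , eq , lt)) = inj₂ (k , (λ i i<k → cong (w i +_) (eq i i<k)) , +-monoʳ-< (w k) lt)

⊕-monoˡ-≤ₗ : ∀ w → a ≤ₗ b → a ⊕ w ≤ₗ b ⊕ w
⊕-monoˡ-≤ₗ w (inj₁ a≗b)            = inj₁ (λ i → cong (_+ w i) (a≗b i))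
⊕-monoˡ-≤ₗ w (inj₂ (k , eq , lt)) = inj₂ (k , (λ i i<k → cong (_+ w i) (eq i i<k)) , +-monoˡ-< (w k) lt)

⊕-cancelˡ-≤ₗ : ∀ w → w ⊕ a ≤ₗ w ⊕ b → a ≤ₗ b
⊕-cancelˡ-≤ₗ w (inj₁ eq)            = inj₁ (λ i → +-cancelˡ-≡ (w i) _ _ (eq i))
⊕-cancelˡ-≤ₗ w (inj₂ (k , eq , lt)) = inj₂ (k , (λ i i<k → +-cancelˡ-≡ (w i) _ _ (eq i i<k)) , +-cancelˡ-< (w k) _ _ lt)

EqualFrom : ℕ → Monomial → Monomial → Set
EqualFrom B a b = ∀ i → B ≤ i → a i ≡ b i

<ₗ-step : a 0 ≡ b 0 → a ∘ suc <ₗ b ∘ suc → a <ₗ b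
<ₗ-step a₀≡b₀ (k , eq , lt) = suc k , (λ { zero _ → a₀≡b₀ ; (suc i) i<k → eq i (s<s⁻¹ i<k) }) , lt

lex-trichotomy : ∀ B a b → EqualFrom B a b → a ≗ b ⊎ a <ₗ b ⊎ b <ₗ a
lex-trichotomy zero    a b eq = inj₁ (λ i → eq i z≤n)
lex-trichotomy (suc B) a b eq with <-cmp (a 0) (b 0)
... | tri< a₀<b₀ _ _ = inj₂ (inj₁ (0 , (λ _ ()) , a₀<b₀))
... | tri> _ _ b₀<a₀ = inj₂ (inj₂ (0 , (λ _ ()) , b₀<a₀))
... | tri≈ _ a₀≡b₀ _ with lex-trichotomy B (a ∘ suc) (b ∘ suc) (λ i B≤i → eq (suc i) (s≤s B≤i))
...   | inj₁ eq'          = inj₁ (λ { zero → a₀≡b₀ ; (suc i) → eq' i })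
...   | inj₂ (inj₁ a'<b') = inj₂ (inj₁ (<ₗ-step a₀≡b₀ a'<b'))
...   | inj₂ (inj₂ b'<a') = inj₂ (inj₂ (<ₗ-step (sym a₀≡b₀) b'<a'))

≤ₗ-total : ∀ B → EqualFrom B a b → a ≤ₗ b ⊎ b ≤ₗ a
≤ₗ-total {a} {b} B eq with lex-trichotomy B a b eq
... | inj₁ a≗b        = inj₁ (inj₁ a≗b)
... | inj₂ (inj₁ a<b) = inj₁ (inj₂ a<b)
... | inj₂ (inj₂ b<a) = inj₂ (inj₂ b<a)

partialSum : Monomial → ℕ → ℕ
partialSum a zero    = 0
partialSum a (suc c) = partialSum a c + a c

partialSum-cong : ∀ c → (∀ i → i < c → a i ≡ b i) → partialSum a c ≡ partialSum b c
partialSum-cong zero    _  = refl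
partialSum-cong (suc c) eq = cong₂ _+_ (partialSum-cong c (λ i i<c → eq i (m<n⇒m<1+n i<c))) (eq c ≤-refl)

partialSum-≤⇒≤ₗ : ∀ B → EqualFrom B a b → (∀ c → partialSum a c ≤ partialSum b c) → a ≤ₗ b
partialSum-≤⇒≤ₗ {a} {b} B eq ≤ with lex-trichotomy B a b eq
... | inj₁ a≗b                 = inj₁ a≗b
... | inj₂ (inj₁ a<b)          = inj₂ a<b
... | inj₂ (inj₂ (k , eq' , lt)) = ⊥-elim (<-irrefl refl (≤-<-trans (≤ (suc k)) b<a))
  where
  b<a : partialSum b (suc k) < partialSum a (suc k)
  b<a = subst (λ s → partialSum b k + b k < s + a k) (partialSum-cong k eq') (+-monoʳ-< (partialSum b k) lt)

exponents-equalFrom : ∀ xs ys → EqualFrom (suc (sum xs + sum ys)) (exponents xs) (exponents ys)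
exponents-equalFrom xs ys i bound =
  trans (exponents-vanish xs (<-≤-trans (s≤s (m≤m+n _ _)) bound))
        (sym (exponents-vanish ys (<-≤-trans (s≤s (m≤n+m _ _)) bound)))

infix 4 _⪯_

record _⪯_ (xs ys : List ℕ) : Set where
  constructor mk⪯
  field exponents-≤ₗ : exponents xs ≤ₗ exponents ys
open _⪯_

⪯-refl : xs ⪯ xs
⪯-refl = mk⪯ ≤ₗ-refl

⪯-trans : xs ⪯ ys → ys ⪯ zs → xs ⪯ zs
⪯-trans (mk⪯ p) (mk⪯ q) = mk⪯ (≤ₗ-trans p q)

⪯-total : ∀ xs ys → xs ⪯ ys ⊎ ys ⪯ xs
⪯-total xs ys with ≤ₗ-total _ (exponents-equalFrom xs ys)
... | inj₁ p = inj₁ (mk⪯ p)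
... | inj₂ p = inj₂ (mk⪯ p)

⪯-antisym : xs ⪯ ys → ys ⪯ xs → xs ↭ ys
⪯-antisym (mk⪯ p) (mk⪯ q) = exponents-injective _ _ (≤ₗ-antisym p q)

⪯-resp-↭ : xs ↭ x → ys ↭ y → xs ⪯ ys → x ⪯ y
⪯-resp-↭ p q (mk⪯ r) = mk⪯ (≤ₗ-resp-≗ (exponents-↭ p) (exponents-↭ q) r)

++-monoʳ-⪯ : ∀ zs → xs ⪯ ys → zs ++ xs ⪯ zs ++ ys
++-monoʳ-⪯ {xs} {ys} zs (mk⪯ p) = mk⪯
  (≤ₗ-resp-≗ (sym ∘ exponents-++ zs xs) (sym ∘ exponents-++ zs ys) (⊕-monoʳ-≤ₗ (exponents zs) p))

++-monoˡ-⪯ : ∀ zs → xs ⪯ ys → xs ++ zs ⪯ ys ++ zs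
++-monoˡ-⪯ {xs} {ys} zs (mk⪯ p) = mk⪯
  (≤ₗ-resp-≗ (sym ∘ exponents-++ xs zs) (sym ∘ exponents-++ ys zs) (⊕-monoˡ-≤ₗ (exponents zs) p))

++-cancelˡ-⪯ : ∀ zs → zs ++ xs ⪯ zs ++ ys → xs ⪯ ys
++-cancelˡ-⪯ {xs} {ys} zs (mk⪯ p) = mk⪯
  (⊕-cancelˡ-≤ₗ (exponents zs) (≤ₗ-resp-≗ (exponents-++ zs xs) (exponents-++ zs ys) p))

++-cancelˡ-↭ : ∀ zs → zs ++ xs ↭ zs ++ ys → xs ↭ ys
++-cancelˡ-↭ []       p = p
++-cancelˡ-↭ (z ∷ zs) p = ++-cancelˡ-↭ zs (↭.drop-∷ p)

-- SubSum k X S : S is the product of k of the monomials listed in X.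
data SubSum : ℕ → List (List ℕ) → List ℕ → Set where
  []   : SubSum 0 [] []
  skip : ∀ {k x X S} → SubSum k X S → SubSum k (x ∷ X) S
  take : ∀ {k x X S} → SubSum k X S → SubSum (suc k) (x ∷ X) (x ++ S)

MinSubSum : ℕ → List (List ℕ) → List ℕ → Set
MinSubSum k X S = SubSum k X S × (∀ {S'} → SubSum k X S' → S ⪯ S')

subSum-≤-length : SubSum k X S → k ≤ length X
subSum-≤-length []       = z≤n
subSum-≤-length (skip s) = m≤n⇒m≤1+n (subSum-≤-length s)
subSum-≤-length (take s) = s≤s (subSum-≤-length s)

subSum-zero : SubSum 0 X S → S ≡ []
subSum-zero []       = refl
subSum-zero (skip s) = subSum-zero s

subSum-empty : ∀ X → SubSum 0 X []
subSum-empty []      = []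
subSum-empty (x ∷ X) = skip (subSum-empty X)

subSum-↭ : X ↭ Y → SubSum k X S → ∃ λ S' → SubSum k Y S' × S ↭ S'
subSum-↭ Perm.refl s = _ , s , ↭-refl
subSum-↭ (Perm.prep x p) (skip s) with subSum-↭ p s
... | S' , s' , e = S' , skip s' , e
subSum-↭ (Perm.prep x p) (take s) with subSum-↭ p s
... | S' , s' , e = x ++ S' , take s' , ↭.++⁺ˡ x e
subSum-↭ (Perm.swap x y p) (skip (skip s)) with subSum-↭ p s
... | S' , s' , e = S' , skip (skip s') , e
subSum-↭ (Perm.swap x y p) (skip (take s)) with subSum-↭ p s
... | S' , s' , e = y ++ S' , take (skip s') , ↭.++⁺ˡ y e
subSum-↭ (Perm.swap x y p) (take (skip s)) with subSum-↭ p s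
... | S' , s' , e = x ++ S' , skip (take s') , ↭.++⁺ˡ x e
subSum-↭ (Perm.swap x y p) (take (take s)) with subSum-↭ p s
... | S' , s' , e = y ++ x ++ S' , take (take s') , ↭-trans (↭.shifts x y) (↭.++⁺ˡ y (↭.++⁺ˡ x e))
subSum-↭ (Perm.trans p q) s with subSum-↭ p s
... | S₁ , s₁ , e₁ with subSum-↭ q s₁
... | S₂ , s₂ , e₂ = S₂ , s₂ , ↭-trans e₁ e₂

subSum-pick : SubSum (suc k) X S →
  ∃₂ λ ys x → ∃₂ λ zs S' → X ≡ ys ++ x ∷ zs × S ≡ x ++ S' × SubSum k (ys ++ zs) S'
subSum-pick (skip {x = y} s) with subSum-pick s
... | ys , x , zs , S' , refl , refl , s' = y ∷ ys , x , zs , S' , refl , refl , skip s'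
subSum-pick (take {x = x} {X = X} {S = S} s) = [] , x , X , S , refl , refl , s

subSum-insert : ∀ ys x zs → SubSum k (ys ++ zs) S → SubSum k (ys ++ x ∷ zs) S
subSum-insert []       x zs s        = skip s
subSum-insert (y ∷ ys) x zs (skip s) = skip (subSum-insert ys x zs s)
subSum-insert (y ∷ ys) x zs (take s) = take (subSum-insert ys x zs s)

subSum-single : ∀ ys x zs → SubSum 1 (ys ++ x ∷ zs) (x ++ [])
subSum-single []       x zs = take (subSum-empty zs)
subSum-single (y ∷ ys) x zs = skip (subSum-single ys x zs)

minSubSum-exists : ∀ k X → k ≤ length X → ∃ (MinSubSum k X)
minSubSum-exists zero    X       _       = [] , subSum-empty X , λ s → subst ([] ⪯_) (sym (subSum-zero s)) ⪯-refl
minSubSum-exists (suc k) (x ∷ X) (s≤s k≤) with minSubSum-exists k X k≤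
... | A , sA , minA with suc k ≤? length X
...   | no k≰ = x ++ A , take sA , λ { (skip s) → ⊥-elim (k≰ (subSum-≤-length s)) ; (take s) → ++-monoʳ-⪯ x (minA s) }
...   | yes k< with minSubSum-exists (suc k) X k<
...     | B , sB , minB with ⪯-total (x ++ A) B
...       | inj₁ xA⪯B = x ++ A , take sA , λ { (skip s) → ⪯-trans xA⪯B (minB s) ; (take s) → ++-monoʳ-⪯ x (minA s) }
...       | inj₂ B⪯xA = B , skip sB , λ { (skip s) → minB s ; (take s) → ⪯-trans B⪯xA (++-monoʳ-⪯ x (minA s)) }

minSubSum-remove : ∀ {k T} ys x zs → (∀ {S} → SubSum 1 (ys ++ x ∷ zs) S → x ++ [] ⪯ S) →
  MinSubSum (suc k) (ys ++ x ∷ zs) T → ∃ λ T' → MinSubSum k (ys ++ zs) T' × T ↭ x ++ T'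
minSubSum-remove {k = k} {T = T} ys x zs minx (sT , minT) = splitOnFirst (subSum-↭ moveFront sT)
  where
  moveFront : ys ++ x ∷ zs ↭ x ∷ ys ++ zs
  moveFront = ↭.shift x ys zs

  T⪯x++ : SubSum k (ys ++ zs) S → T ⪯ x ++ S
  T⪯x++ s with subSum-↭ (↭-sym moveFront) (take s)
  ... | _ , s' , e = ⪯-resp-↭ ↭-refl (↭-sym e) (minT s')

  conclude : SubSum k (ys ++ zs) S → T ↭ x ++ S → ∃ λ T' → MinSubSum k (ys ++ zs) T' × T ↭ x ++ T'
  conclude s e = _ , (s , λ s' → ++-cancelˡ-⪯ x (⪯-resp-↭ e ↭-refl (T⪯x++ s'))) , e

  x⪯member : ∀ ys' z zs' → ys ++ zs ≡ ys' ++ z ∷ zs' → x ⪯ z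
  x⪯member ys' z zs' eq with subSum-↭ (↭-sym moveFront) (skip (subst (λ W → SubSum 1 W (z ++ [])) (sym eq) (subSum-single ys' z zs')))
  ... | _ , s , e = ⪯-resp-↭ (↭.++-identityʳ x) (↭-trans (↭-sym e) (↭.++-identityʳ z)) (minx s)

  splitOnFirst : (∃ λ S → SubSum (suc k) (x ∷ ys ++ zs) S × T ↭ S) → ∃ λ T' → MinSubSum k (ys ++ zs) T' × T ↭ x ++ T'
  splitOnFirst (_ , take s , e) = conclude s e
  splitOnFirst (_ , skip s , e) with subSum-pick s
  ... | ys' , z , zs' , T' , eq , refl , s' =
    conclude s'' (⪯-antisym (T⪯x++ s'') (⪯-resp-↭ ↭-refl (↭-sym e) (++-monoˡ-⪯ T' (x⪯member ys' z zs' eq))))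
    where
    s'' : SubSum k (ys ++ zs) T'
    s'' = subst (λ W → SubSum k W T') (sym eq) (subSum-insert ys' z zs' s')

module ≋ = SetoidPerm (Perm.↭-setoid {A = ℕ})

SameMinSubSums : List (List ℕ) → List (List ℕ) → Set
SameMinSubSums X Y = ∀ k → k ≤ length X → ∃₂ λ S S' → MinSubSum k X S × MinSubSum k Y S' × S ↭ S'

length-remove : ∀ ys (x : List ℕ) zs → length (ys ++ x ∷ zs) ≡ suc (length (ys ++ zs))
length-remove ys x zs = ↭.↭-length (↭.shift x ys zs)

-- A smallest 1-fold product is a smallest member; remove it from both sides and recurse.
≋-fromMinSubSums : ∀ n {X Y : List (List ℕ)} → length X ≡ n → length Y ≡ n → SameMinSubSums X Y → X ≋ Y
≋-fromMinSubSums zero    {[]}    {[]}    _  _  _ = MonPerm.↭-refl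
≋-fromMinSubSums zero    {_ ∷ _}         () _  _
≋-fromMinSubSums zero    {[]}    {_ ∷ _} _  () _
≋-fromMinSubSums (suc n) {X} {Y} ∣X∣ ∣Y∣ same
  with same 1 (subst (1 ≤_) (sym ∣X∣) (s≤s z≤n))
... | _ , _ , (sX , minX) , (sY , minY) , x++[]↭y++[] with subSum-pick sX | subSum-pick sY
... | ys , x , zs , _ , refl , refl , s₀ | ys' , y , zs' , _ , refl , refl , s₀'
  with subSum-zero s₀ | subSum-zero s₀'
... | refl | refl =
  MonPerm.↭-trans (≋.↭-shift ys zs)
    (MonPerm.↭-trans (MonPerm.prep x↭y (≋-fromMinSubSums n ∣rest∣ ∣rest'∣ same'))
      (MonPerm.↭-sym (≋.↭-shift ys' zs')))
  where
  x↭y : x ↭ y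
  x↭y = ↭-trans (↭-sym (↭.++-identityʳ x)) (↭-trans x++[]↭y++[] (↭.++-identityʳ y))
  ∣rest∣ : length (ys ++ zs) ≡ n
  ∣rest∣ = suc-injective (trans (sym (length-remove ys x zs)) ∣X∣)
  ∣rest'∣ : length (ys' ++ zs') ≡ n
  ∣rest'∣ = suc-injective (trans (sym (length-remove ys' y zs')) ∣Y∣)
  same' : SameMinSubSums (ys ++ zs) (ys' ++ zs')
  same' k k≤ with same (suc k) (subst (suc k ≤_) (sym (length-remove ys x zs)) (s≤s k≤))
  ... | T₁ , T₂ , m₁ , m₂ , T₁↭T₂ with minSubSum-remove ys x zs minX m₁ | minSubSum-remove ys' y zs' minY m₂
  ... | T₁' , m₁' , e₁ | T₂' , m₂' , e₂ = T₁' , T₂' , m₁' , m₂' ,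
    ++-cancelˡ-↭ x (↭-trans (↭-sym e₁) (↭-trans T₁↭T₂ (↭-trans e₂ (↭.++⁺ʳ T₂' (↭-sym x↭y)))))

mutual
  byDepth : ℕ → Tree → LTree
  byDepth x (node ts) = lnode x (byDepthL (suc x) ts)

  byDepthL : ℕ → List Tree → List LTree
  byDepthL x []       = []
  byDepthL x (t ∷ ts) = byDepth x t ∷ byDepthL x ts

-- Choice d t : a set of vertices of t at coheight d (true = chosen).
mutual
  data Choice : ℕ → Tree → Set where
    leaf  : ∀ {t} → Bool → Choice zero t
    below : ∀ {d ts} → Choices d ts → Choice (suc d) (node ts)

  data Choices (d : ℕ) : List Tree → Set where
    []  : Choices d []
    _∷_ : ∀ {t ts} → Choice d t → Choices d ts → Choices d (t ∷ ts)

mutual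
  raise : ∀ {d t} → ℕ → Choice d t → LTree
  raise x (leaf {t} false) = byDepth x t
  raise x (leaf {t} true)  = byDepth (suc x) t
  raise x (below cs)       = lnode x (raiseL (suc x) cs)

  raiseL : ∀ {d ts} → ℕ → Choices d ts → List LTree
  raiseL x []       = []
  raiseL x (c ∷ cs) = raise x c ∷ raiseL x cs

mutual
  #chosen : ∀ {d t} → Choice d t → ℕ
  #chosen (leaf false) = 0
  #chosen (leaf true)  = 1
  #chosen (below cs)   = #chosenL cs

  #chosenL : ∀ {d ts} → Choices d ts → ℕ
  #chosenL []       = 0
  #chosenL (c ∷ cs) = #chosen c + #chosenL cs

-- The trailing ++ [] makes a single chosen profile literally the product built by SubSum.take.
mutual
  chosenDepths : ∀ {d t} → ℕ → Choice d t → List ℕ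
  chosenDepths a (leaf false)     = []
  chosenDepths a (leaf {t} true)  = depths a t ++ []
  chosenDepths a (below cs)       = chosenDepthsL (suc a) cs

  chosenDepthsL : ∀ {d ts} → ℕ → Choices d ts → List ℕ
  chosenDepthsL a []       = []
  chosenDepthsL a (c ∷ cs) = chosenDepths a c ++ chosenDepthsL a cs

mutual
  level : ℕ → ℕ → Tree → List (List ℕ)
  level a zero    t         = depths a t ∷ []
  level a (suc d) (node ts) = levelL (suc a) d ts

  levelL : ℕ → ℕ → List Tree → List (List ℕ)
  levelL a d []       = []
  levelL a d (t ∷ ts) = level a d t ++ levelL a d ts

subSum-++ : ∀ {k k' X X' S S'} → SubSum k X S → SubSum k' X' S' → SubSum (k + k') (X ++ X') (S ++ S')
subSum-++ []       s' = s'
subSum-++ (skip s) s' = skip (subSum-++ s s')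
subSum-++ {S' = S'} (take {x = x} {S = S} s) s' = subst (SubSum _ _) (sym (++-assoc x S S')) (take (subSum-++ s s'))

subSum-split : ∀ X {X' k S} → SubSum k (X ++ X') S →
  ∃₂ λ k₁ k₂ → ∃₂ λ S₁ S₂ → k ≡ k₁ + k₂ × S ≡ S₁ ++ S₂ × SubSum k₁ X S₁ × SubSum k₂ X' S₂
subSum-split []      s = 0 , _ , [] , _ , refl , refl , [] , s
subSum-split (x ∷ X) (skip s) with subSum-split X s
... | k₁ , k₂ , S₁ , S₂ , refl , refl , s₁ , s₂ = k₁ , k₂ , S₁ , S₂ , refl , refl , skip s₁ , s₂
subSum-split (x ∷ X) (take s) with subSum-split X s
... | k₁ , k₂ , S₁ , S₂ , refl , refl , s₁ , s₂ =
  suc k₁ , k₂ , x ++ S₁ , S₂ , refl , sym (++-assoc x S₁ S₂) , take s₁ , s₂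

mutual
  choice⇒subSum : ∀ a {d t} (c : Choice d t) → SubSum (#chosen c) (level a d t) (chosenDepths a c)
  choice⇒subSum a (leaf false) = skip []
  choice⇒subSum a (leaf true)  = take []
  choice⇒subSum a (below cs)   = choices⇒subSum (suc a) cs

  choices⇒subSum : ∀ a {d ts} (cs : Choices d ts) → SubSum (#chosenL cs) (levelL a d ts) (chosenDepthsL a cs)
  choices⇒subSum a []       = []
  choices⇒subSum a (c ∷ cs) = subSum-++ (choice⇒subSum a c) (choices⇒subSum a cs)

mutual
  subSum⇒choice : ∀ a d t {k S} → SubSum k (level a d t) S →
    ∃ λ (c : Choice d t) → #chosen c ≡ k × chosenDepths a c ≡ S
  subSum⇒choice a zero    t (skip []) = leaf false , refl , refl
  subSum⇒choice a zero    t (take []) = leaf true , refl , refl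
  subSum⇒choice a (suc d) (node ts) s with subSum⇒choices (suc a) d ts s
  ... | cs , refl , refl = below cs , refl , refl

  subSum⇒choices : ∀ a d ts {k S} → SubSum k (levelL a d ts) S →
    ∃ λ (cs : Choices d ts) → #chosenL cs ≡ k × chosenDepthsL a cs ≡ S
  subSum⇒choices a d []       [] = [] , refl , refl
  subSum⇒choices a d (t ∷ ts) s with subSum-split (level a d t) s
  ... | _ , _ , _ , _ , refl , refl , s₁ , s₂ with subSum⇒choice a d t s₁ | subSum⇒choices a d ts s₂
  ... | c , refl , refl | cs , refl , refl = c ∷ cs , refl , refl

mutual
  labelList : LTree → List ℕ
  labelList (lnode x ls) = x ∷ labelListL ls

  labelListL : List LTree → List ℕ
  labelListL []       = []
  labelListL (l ∷ ls) = labelList l ++ labelListL ls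

mutual
  cnt≡exponents : ∀ i L → cnt i L ≡ exponents (labelList L) i
  cnt≡exponents i (lnode x ls) = cong (bump i x) (cntL≡exponents i ls)

  cntL≡exponents : ∀ i ls → cntL i ls ≡ exponents (labelListL ls) i
  cntL≡exponents i []       = refl
  cntL≡exponents i (l ∷ ls) =
    trans (cong₂ _+_ (cnt≡exponents i l) (cntL≡exponents i ls)) (sym (exponents-++ (labelList l) (labelListL ls) i))

mutual
  labelList-byDepth : ∀ a t → labelList (byDepth a t) ≡ depths a t
  labelList-byDepth a (node ts) = cong (a ∷_) (labelListL-byDepthL (suc a) ts)

  labelListL-byDepthL : ∀ a ts → labelListL (byDepthL a ts) ≡ depthsL a ts
  labelListL-byDepthL a []       = refl
  labelListL-byDepthL a (t ∷ ts) = cong₂ _++_ (labelList-byDepth a t) (labelListL-byDepthL a ts)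

mutual
  depths-suc : ∀ a t → depths (suc a) t ≡ map suc (depths a t)
  depths-suc a (node ts) = cong (suc a ∷_) (depthsL-suc (suc a) ts)

  depthsL-suc : ∀ a ts → depthsL (suc a) ts ≡ map suc (depthsL a ts)
  depthsL-suc a []       = refl
  depthsL-suc a (t ∷ ts) = trans (cong₂ _++_ (depths-suc a t) (depthsL-suc a ts)) (sym (map-++ suc (depths a t) (depthsL a ts)))

mutual
  chosenDepths-suc : ∀ a {d t} (c : Choice d t) → chosenDepths (suc a) c ≡ map suc (chosenDepths a c)
  chosenDepths-suc a (leaf false)    = refl
  chosenDepths-suc a (leaf {t} true) = trans (cong (_++ []) (depths-suc a t)) (sym (map-++ suc (depths a t) []))
  chosenDepths-suc a (below cs)      = chosenDepthsL-suc (suc a) cs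

  chosenDepthsL-suc : ∀ a {d ts} (cs : Choices d ts) → chosenDepthsL (suc a) cs ≡ map suc (chosenDepthsL a cs)
  chosenDepthsL-suc a []       = refl
  chosenDepthsL-suc a (c ∷ cs) =
    trans (cong₂ _++_ (chosenDepths-suc a c) (chosenDepthsL-suc a cs)) (sym (map-++ suc (chosenDepths a c) (chosenDepthsL a cs)))

↭-interchange : ∀ {A : Set} (as bs cs ds : List A) → (as ++ bs) ++ (cs ++ ds) ↭ (as ++ cs) ++ (bs ++ ds)
↭-interchange as bs cs ds = ↭-trans (↭-reflexive (++-assoc as bs (cs ++ ds)))
  (↭-trans (↭.++⁺ˡ as (↭.shifts bs cs)) (↭-reflexive (sym (++-assoc as cs (bs ++ ds)))))

-- Raising the chosen subtrees moves their vertex counts up by one coheight.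
mutual
  raise-labels : ∀ a {d t} (c : Choice d t) →
    labelList (raise a c) ++ chosenDepths a c ↭ depths a t ++ map suc (chosenDepths a c)
  raise-labels a (leaf {t} false) = ↭-reflexive (cong (_++ []) (labelList-byDepth a t))
  raise-labels a (leaf {t} true)  = begin
    labelList (byDepth (suc a) t) ++ (depths a t ++ [])
      ≡⟨ cong₂ _++_ (trans (labelList-byDepth (suc a) t) (depths-suc a t)) (++-identityʳ (depths a t)) ⟩
    map suc (depths a t) ++ depths a t
      ↭⟨ ↭.++-comm (map suc (depths a t)) (depths a t) ⟩
    depths a t ++ map suc (depths a t)
      ≡⟨ cong (λ xs → depths a t ++ map suc xs) (++-identityʳ (depths a t)) ⟨
    depths a t ++ map suc (depths a t ++ []) ∎
    where open Perm.PermutationReasoning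
  raise-labels a (below cs)       = Perm.prep a (raiseL-labels (suc a) cs)

  raiseL-labels : ∀ a {d ts} (cs : Choices d ts) →
    labelListL (raiseL a cs) ++ chosenDepthsL a cs ↭ depthsL a ts ++ map suc (chosenDepthsL a cs)
  raiseL-labels a []                     = ↭-refl
  raiseL-labels a (_∷_ {t} {ts} c cs) = begin
    (labelList (raise a c) ++ labelListL (raiseL a cs)) ++ (chosenDepths a c ++ chosenDepthsL a cs)
      ↭⟨ ↭-interchange (labelList (raise a c)) (labelListL (raiseL a cs)) (chosenDepths a c) _ ⟩
    (labelList (raise a c) ++ chosenDepths a c) ++ (labelListL (raiseL a cs) ++ chosenDepthsL a cs)
      ↭⟨ ↭.++⁺ (raise-labels a c) (raiseL-labels a cs) ⟩
    (depths a t ++ map suc (chosenDepths a c)) ++ (depthsL a ts ++ map suc (chosenDepthsL a cs))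
      ↭⟨ ↭-interchange (depths a t) (map suc (chosenDepths a c)) (depthsL a ts) _ ⟩
    (depths a t ++ depthsL a ts) ++ (map suc (chosenDepths a c) ++ map suc (chosenDepthsL a cs))
      ≡⟨ cong (_ ++_) (map-++ suc (chosenDepths a c) (chosenDepthsL a cs)) ⟨
    (depths a t ++ depthsL a ts) ++ map suc (chosenDepths a c ++ chosenDepthsL a cs) ∎
    where open Perm.PermutationReasoning

↑ : Monomial → Monomial
↑ a zero    = 0
↑ a (suc i) = a i

exponents-map-suc : ∀ xs → exponents (map suc xs) ≗ ↑ (exponents xs)
exponents-map-suc []       zero    = refl
exponents-map-suc []       (suc i) = refl
exponents-map-suc (x ∷ xs) zero    = exponents-map-suc xs zero
exponents-map-suc (x ∷ xs) (suc i) = cong (bump i x) (exponents-map-suc xs (suc i))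

↑-cong< : ∀ j → (∀ i → i < j → a i ≡ b i) → ∀ i → i < suc j → ↑ a i ≡ ↑ b i
↑-cong< j eq zero    _   = refl
↑-cong< j eq (suc i) i<j = eq i (s<s⁻¹ i<j)

↑-cong : a ≗ b → ↑ a ≗ ↑ b
↑-cong eq zero    = refl
↑-cong eq (suc i) = eq i

-- Raised p q g : g is p with the exponents q moved up by one index.
Raised : Monomial → Monomial → Monomial → Set
Raised p q g = g ⊕ ↑ q ≗ p ⊕ ↑ (↑ q)

private
  variable
    p p' q q' g g' : Monomial

raised-cancel : Raised p q g → Raised p' q' g' →
  ∀ i → p i ≡ p' i → ↑ q i ≡ ↑ q' i → ↑ (↑ q) i ≡ ↑ (↑ q') i → g i ≡ g' i
raised-cancel {p} {q} {g} {p'} {q'} {g'} r r' i p≡ ↑q≡ ↑↑q≡ = +-cancelʳ-≡ (↑ q i) (g i) (g' i) (begin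
  g i + ↑ q i      ≡⟨ r i ⟩
  p i + ↑ (↑ q) i  ≡⟨ cong₂ _+_ p≡ ↑↑q≡ ⟩
  p' i + ↑ (↑ q') i ≡⟨ r' i ⟨
  g' i + ↑ q' i    ≡⟨ cong (g' i +_) ↑q≡ ⟨
  g' i + ↑ q i     ∎)
  where open ≡-Reasoning

raised-injective : Raised p q g → Raised p' q' g' → g ≗ g' → p ≗ p' → q ≗ q'
raised-injective {p} {q} {g} {p'} {q'} {g'} r r' g≗g' p≗p' i = ↑q≗↑q' (suc i)
  where
  ↑q≗↑q' : ↑ q ≗ ↑ q'
  ↑q≗↑q' zero    = refl
  ↑q≗↑q' (suc i) = +-cancelˡ-≡ (g (suc i)) (q i) (q' i) (begin
    g (suc i) + q i              ≡⟨ r (suc i) ⟩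
    p (suc i) + ↑ q i            ≡⟨ cong₂ _+_ (p≗p' (suc i)) (↑q≗↑q' i) ⟩
    p' (suc i) + ↑ q' i          ≡⟨ r' (suc i) ⟨
    g' (suc i) + q' i            ≡⟨ cong (_+ q' i) (g≗g' (suc i)) ⟨
    g (suc i) + q' i             ∎)
    where open ≡-Reasoning

raised-antitone : Raised p q g → Raised p q' g' → q ≤ₗ q' → g' ≤ₗ g
raised-antitone {p} {q} {g} {q'} {g'} r r' (inj₁ q≗q') =
  inj₁ (λ i → raised-cancel r' r i refl (↑-cong (sym ∘ q≗q') i) (↑-cong (↑-cong (sym ∘ q≗q')) i))
raised-antitone {p} {q} {g} {q'} {g'} r r' (inj₂ (j , eq , q<q')) = inj₂ (suc j , g'≡g , g'<g)
  where
  ↑eq : ∀ i → i < suc j → ↑ q' i ≡ ↑ q i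
  ↑eq = ↑-cong< j (λ i i<j → sym (eq i i<j))
  g'≡g : ∀ i → i < suc j → g' i ≡ g i
  g'≡g i i<j = raised-cancel r' r i refl (↑eq i i<j) (↑-cong< (suc j) ↑eq i (m<n⇒m<1+n i<j))
  g'<g : g' (suc j) < g (suc j)
  g'<g = +-cancelʳ-< (q j) (g' (suc j)) (g (suc j)) (subst (g' (suc j) + q j <_) (begin
    g' (suc j) + q' j      ≡⟨ r' (suc j) ⟩
    p (suc j) + ↑ q' j     ≡⟨ cong (p (suc j) +_) (↑eq j ≤-refl) ⟩
    p (suc j) + ↑ q j      ≡⟨ r (suc j) ⟨
    g (suc j) + q j        ∎) (+-monoʳ-< (g' (suc j)) q<q'))
    where open ≡-Reasoning

↑-vanish : ∀ d → (∀ i → i < d → q i ≡ 0) → ∀ i → i ≤ d → ↑ q i ≡ 0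
↑-vanish d q₀ zero    _   = refl
↑-vanish d q₀ (suc i) i<d = q₀ i i<d

raised-below : ∀ d → Raised p q g → (∀ i → i < d → q i ≡ 0) → ∀ i → i ≤ d → g i ≡ p i
raised-below {p} {q} {g} d r q₀ i i≤d = +-cancelʳ-≡ (↑ q i) (g i) (p i)
  (trans (r i) (cong (p i +_) (trans (↑↑q₀ i i≤d) (sym (↑-vanish d q₀ i i≤d)))))
  where
  ↑↑q₀ : ∀ i → i ≤ d → ↑ (↑ q) i ≡ 0
  ↑↑q₀ zero    _   = refl
  ↑↑q₀ (suc i) i<d = ↑-vanish d q₀ i (<⇒≤ i<d)

raised-top : ∀ d → Raised p q g → (∀ i → i < d → q i ≡ 0) → g (suc d) + q d ≡ p (suc d)
raised-top {p} d r q₀ = trans (r (suc d)) (trans (cong (p (suc d) +_) (↑-vanish d q₀ d ≤-refl)) (+-identityʳ _))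

mutual
  depths-below : ∀ a t → i < a → exponents (depths a t) i ≡ 0
  depths-below a (node ts) i<a = trans (bump-≢ _ (λ i≡a → <-irrefl i≡a i<a)) (depthsL-below (suc a) ts (m<n⇒m<1+n i<a))

  depthsL-below : ∀ a ts → i < a → exponents (depthsL a ts) i ≡ 0
  depthsL-below a []       i<a = refl
  depthsL-below {i} a (t ∷ ts) i<a =
    trans (exponents-++ (depths a t) (depthsL a ts) i) (cong₂ _+_ (depths-below a t i<a) (depthsL-below a ts i<a))

depths-root : ∀ a t → exponents (depths a t) a ≡ 1
depths-root a (node ts) = trans (bump-≡ a _) (cong suc (depthsL-below (suc a) ts ≤-refl))

mutual
  chosenDepths-below : ∀ a {d t} (c : Choice d t) → i < a + d → exponents (chosenDepths a c) i ≡ 0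
  chosenDepths-below a (leaf false) _ = refl
  chosenDepths-below {i} a (leaf {t} true) i<a =
    trans (exponents-++ (depths a t) [] i) (trans (+-identityʳ _) (depths-below a t (subst (i <_) (+-identityʳ a) i<a)))
  chosenDepths-below {i} a {suc d} (below cs) i<a+d = chosenDepthsL-below (suc a) cs (subst (i <_) (+-suc a d) i<a+d)

  chosenDepthsL-below : ∀ a {d ts} (cs : Choices d ts) → i < a + d → exponents (chosenDepthsL a cs) i ≡ 0
  chosenDepthsL-below a []       _ = refl
  chosenDepthsL-below {i} a (c ∷ cs) i<a+d =
    trans (exponents-++ (chosenDepths a c) (chosenDepthsL a cs) i)
          (cong₂ _+_ (chosenDepths-below a c i<a+d) (chosenDepthsL-below a cs i<a+d))

mutual
  chosenDepths-at : ∀ a {d t} (c : Choice d t) → exponents (chosenDepths a c) (a + d) ≡ #chosen c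
  chosenDepths-at a (leaf false) = refl
  chosenDepths-at a (leaf {t} true) rewrite +-identityʳ a =
    trans (exponents-++ (depths a t) [] a) (trans (+-identityʳ _) (depths-root a t))
  chosenDepths-at a {suc d} (below cs) rewrite +-suc a d = chosenDepthsL-at (suc a) cs

  chosenDepthsL-at : ∀ a {d ts} (cs : Choices d ts) → exponents (chosenDepthsL a cs) (a + d) ≡ #chosenL cs
  chosenDepthsL-at a []           = refl
  chosenDepthsL-at a {d} (c ∷ cs) =
    trans (exponents-++ (chosenDepths a c) (chosenDepthsL a cs) (a + d)) (cong₂ _+_ (chosenDepths-at a c) (chosenDepthsL-at a cs))

mutual
  length-level : ∀ a d t → length (level a d t) ≡ exponents (depths a t) (a + d)
  length-level a zero    t rewrite +-identityʳ a = sym (depths-root a t)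
  length-level a (suc d) (node ts) = begin
    length (levelL (suc a) d ts)                    ≡⟨ length-levelL (suc a) d ts ⟩
    exponents (depthsL (suc a) ts) (suc a + d)      ≡⟨ cong (exponents (depthsL (suc a) ts)) (+-suc a d) ⟨
    exponents (depthsL (suc a) ts) (a + suc d)      ≡⟨ bump-≢ _ a+1+d≢a ⟨
    exponents (depths a (node ts)) (a + suc d)      ∎
    where
    open ≡-Reasoning
    a+1+d≢a : a + suc d ≢ a
    a+1+d≢a eq = <-irrefl (sym eq) (subst (a <_) (sym (+-suc a d)) (s≤s (m≤m+n a d)))

  length-levelL : ∀ a d ts → length (levelL a d ts) ≡ exponents (depthsL a ts) (a + d)
  length-levelL a d []       = refl
  length-levelL a d (t ∷ ts) = trans (length-++ (level a d t))
    (trans (cong₂ _+_ (length-level a d t) (length-levelL a d ts)) (sym (exponents-++ (depths a t) (depthsL a ts) (a + d))))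

mutual
  shape-byDepth : ∀ x t → shape (byDepth x t) ≡ t
  shape-byDepth x (node ts) = cong node (shapeL-byDepthL (suc x) ts)

  shapeL-byDepthL : ∀ x ts → shapeL (byDepthL x ts) ≡ ts
  shapeL-byDepthL x []       = refl
  shapeL-byDepthL x (t ∷ ts) = cong₂ _∷_ (shape-byDepth x t) (shapeL-byDepthL x ts)

mutual
  shape-raise : ∀ x {d t} (c : Choice d t) → shape (raise x c) ≡ t
  shape-raise x (leaf {t} false) = shape-byDepth x t
  shape-raise x (leaf {t} true)  = shape-byDepth (suc x) t
  shape-raise x (below cs)       = cong node (shapeL-raiseL (suc x) cs)

  shapeL-raiseL : ∀ x {d ts} (cs : Choices d ts) → shapeL (raiseL x cs) ≡ ts
  shapeL-raiseL x []       = refl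
  shapeL-raiseL x (c ∷ cs) = cong₂ _∷_ (shape-raise x c) (shapeL-raiseL x cs)

mutual
  byDepth-increasing : ∀ {b} x t → b < x → IncFrom b (byDepth x t)
  byDepth-increasing x (node ts) b<x = inc b<x (byDepthL-increasing (suc x) ts ≤-refl)

  byDepthL-increasing : ∀ {b} x ts → b < x → All (IncFrom b) (byDepthL x ts)
  byDepthL-increasing x []       _   = []
  byDepthL-increasing x (t ∷ ts) b<x = byDepth-increasing x t b<x ∷ byDepthL-increasing x ts b<x

mutual
  raise-increasing : ∀ {b} x {d t} (c : Choice d t) → b < x → IncFrom b (raise x c)
  raise-increasing x (leaf {t} false) b<x = byDepth-increasing x t b<x
  raise-increasing x (leaf {t} true)  b<x = byDepth-increasing (suc x) t (m<n⇒m<1+n b<x)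
  raise-increasing x (below cs)       b<x = inc b<x (raiseL-increasing (suc x) cs ≤-refl)

  raiseL-increasing : ∀ {b} x {d ts} (cs : Choices d ts) → b < x → All (IncFrom b) (raiseL x cs)
  raiseL-increasing x []       _   = []
  raiseL-increasing x (c ∷ cs) b<x = raise-increasing x c b<x ∷ raiseL-increasing x cs b<x

colMon≗exponents : ∀ {T} (f : IncColoring T) → colMon f ≗ exponents (labelList (IncColoring.labels f))
colMon≗exponents f i = cnt≡exponents i (IncColoring.labels f)

depthMonomial : Tree → Monomial
depthMonomial T = exponents (depths 1 T)

raisedMonomial : ∀ {d T} → Choice d T → Monomial
raisedMonomial c = exponents (labelList (raise 1 c))

byDepthColoring : ∀ T → IncColoring T
byDepthColoring T = coloring (byDepth 1 T) (shape-byDepth 1 T) (byDepth-increasing 1 T z<s)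

raisedColoring : ∀ {d T} (c : Choice d T) → IncColoring T
raisedColoring c = coloring (raise 1 c) (shape-raise 1 c) (raise-increasing 1 c z<s)

byDepthColoring-monomial : ∀ T → colMon (byDepthColoring T) ≗ depthMonomial T
byDepthColoring-monomial T i = trans (colMon≗exponents (byDepthColoring T) i) (cong (λ xs → exponents xs i) (labelList-byDepth 1 T))

depthMonomial-level : ∀ T d → depthMonomial T (suc d) ≡ length (level 0 d T)
depthMonomial-level T d = begin
  exponents (depths 1 T) (suc d)         ≡⟨ cong (λ xs → exponents xs (suc d)) (depths-suc 0 T) ⟩
  exponents (map suc (depths 0 T)) (suc d) ≡⟨ exponents-map-suc (depths 0 T) (suc d) ⟩
  exponents (depths 0 T) d               ≡⟨ length-level 0 d T ⟨
  length (level 0 d T)                   ∎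
  where open ≡-Reasoning

raised-choice : ∀ {d T} (c : Choice d T) → Raised (depthMonomial T) (exponents (chosenDepths 0 c)) (raisedMonomial c)
raised-choice {T = T} c i = begin
  raisedMonomial c i + ↑ (exponents qs) i                         ≡⟨ cong (raisedMonomial c i +_) (lift i) ⟨
  raisedMonomial c i + exponents (chosenDepths 1 c) i             ≡⟨ exponents-++ (labelList (raise 1 c)) (chosenDepths 1 c) i ⟨
  exponents (labelList (raise 1 c) ++ chosenDepths 1 c) i         ≡⟨ exponents-↭ (raise-labels 1 c) i ⟩
  exponents (depths 1 T ++ map suc (chosenDepths 1 c)) i          ≡⟨ exponents-++ (depths 1 T) _ i ⟩
  depthMonomial T i + exponents (map suc (chosenDepths 1 c)) i    ≡⟨ cong (depthMonomial T i +_) (exponents-map-suc (chosenDepths 1 c) i) ⟩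
  depthMonomial T i + ↑ (exponents (chosenDepths 1 c)) i          ≡⟨ cong (depthMonomial T i +_) (↑-cong lift i) ⟩
  depthMonomial T i + ↑ (↑ (exponents qs)) i                      ∎
  where
  open ≡-Reasoning
  qs : List ℕ
  qs = chosenDepths 0 c
  lift : exponents (chosenDepths 1 c) ≗ ↑ (exponents qs)
  lift j = trans (cong (λ ys → exponents ys j) (chosenDepths-suc 0 c)) (exponents-map-suc qs j)

raisedMonomial-below : ∀ {d T} (c : Choice d T) → ∀ i → i ≤ d → raisedMonomial c i ≡ depthMonomial T i
raisedMonomial-below {d} c = raised-below d (raised-choice c) (λ i i<d → chosenDepths-below 0 c i<d)

raisedMonomial-top : ∀ {d T} (c : Choice d T) → raisedMonomial c (suc d) + #chosen c ≡ depthMonomial T (suc d)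
raisedMonomial-top {d} c =
  trans (cong (raisedMonomial c (suc d) +_) (sym (chosenDepths-at 0 c)))
        (raised-top d (raised-choice c) (λ i i<d → chosenDepths-below 0 c i<d))

isBelow : ℕ → ℕ → ℕ
isBelow x       zero    = 0
isBelow zero    (suc c) = 1
isBelow (suc x) (suc c) = isBelow x c

isBelow-step : ∀ x c → isBelow x (suc c) ≡ isBelow x c + bump c x 0
isBelow-step zero    zero    = refl
isBelow-step zero    (suc c) = refl
isBelow-step (suc x) zero    = refl
isBelow-step (suc x) (suc c) = isBelow-step x c

isBelow-< : ∀ {x c} → x < c → isBelow x c ≡ 1
isBelow-< {zero}  {suc c} _   = refl
isBelow-< {suc x} {suc c} x<c = isBelow-< (s<s⁻¹ x<c)

isBelow-≥ : ∀ {x c} → c ≤ x → isBelow x c ≡ 0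
isBelow-≥ {x}     {zero}  _   = refl
isBelow-≥ {suc x} {suc c} c≤x = isBelow-≥ (s≤s⁻¹ c≤x)

isBelow-pos : ∀ x c → 0 < isBelow x c → x < c
isBelow-pos zero    (suc c) _ = z<s
isBelow-pos (suc x) (suc c) p = s<s (isBelow-pos x c p)

isBelow-≤1 : ∀ x c → isBelow x c ≤ 1
isBelow-≤1 x       zero    = z≤n
isBelow-≤1 zero    (suc c) = ≤-refl
isBelow-≤1 (suc x) (suc c) = isBelow-≤1 x c

isBelow-antitone : ∀ {x y} c → y ≤ x → isBelow x c ≤ isBelow y c
isBelow-antitone {x}     {y}     zero    _         = z≤n
isBelow-antitone {x}     {zero}  (suc c) _         = isBelow-≤1 x (suc c)
isBelow-antitone {suc x} {suc y} (suc c) (s≤s y≤x) = isBelow-antitone c y≤x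

countBelow : ℕ → List ℕ → ℕ
countBelow c []       = 0
countBelow c (x ∷ xs) = isBelow x c + countBelow c xs

countBelow-++ : ∀ c xs ys → countBelow c (xs ++ ys) ≡ countBelow c xs + countBelow c ys
countBelow-++ c []       ys = refl
countBelow-++ c (x ∷ xs) ys = trans (cong (isBelow x c +_) (countBelow-++ c xs ys)) (sym (+-assoc (isBelow x c) _ _))

partialSum-bump : ∀ x a c → partialSum (λ i → bump i x (a i)) c ≡ isBelow x c + partialSum a c
partialSum-bump x a zero    = refl
partialSum-bump x a (suc c) = begin
  partialSum (λ i → bump i x (a i)) c + bump c x (a c)  ≡⟨ cong₂ _+_ (partialSum-bump x a c) (bump-+ c x 0 (a c)) ⟩
  (isBelow x c + partialSum a c) + (bump c x 0 + a c)   ≡⟨ interchange (isBelow x c) (partialSum a c) (bump c x 0) (a c) ⟩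
  (isBelow x c + bump c x 0) + (partialSum a c + a c)   ≡⟨ cong (_+ _) (isBelow-step x c) ⟨
  isBelow x (suc c) + (partialSum a c + a c)            ∎
  where open ≡-Reasoning

partialSum-exponents : ∀ xs c → partialSum (exponents xs) c ≡ countBelow c xs
partialSum-exponents []       zero    = refl
partialSum-exponents []       (suc c) = cong (_+ 0) (partialSum-exponents [] c)
partialSum-exponents (x ∷ xs) c       =
  trans (partialSum-bump x (exponents xs) c) (cong (isBelow x c +_) (partialSum-exponents xs c))

mutual
  data Pointwise (R : ℕ → ℕ → Set) : LTree → LTree → Set where
    lnode : ∀ {a b ls ms} → R a b → PointwiseL R ls ms → Pointwise R (lnode a ls) (lnode b ms)

  data PointwiseL (R : ℕ → ℕ → Set) : List LTree → List LTree → Set where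
    []  : PointwiseL R [] []
    _∷_ : ∀ {l m ls ms} → Pointwise R l m → PointwiseL R ls ms → PointwiseL R (l ∷ ls) (m ∷ ms)

BelowWhenever : ℕ → ℕ → ℕ → Set
BelowWhenever c a b = b < c → a < c

+-≤-tight : ∀ {a a' b b'} → a ≤ a' → b ≤ b' → a' + b' ≤ a + b → a' ≤ a × b' ≤ b
+-≤-tight {a} {a'} {b} {b'} a≤a' b≤b' sum≤ =
  +-cancelʳ-≤ b' a' a (≤-trans sum≤ (+-monoʳ-≤ a b≤b')) , +-cancelˡ-≤ a' b' b (≤-trans sum≤ (+-monoˡ-≤ b a≤a'))

mutual
  pointwise-≥⇒countBelow-≤ : ∀ c {L M} → Pointwise _≥_ L M → countBelow c (labelList L) ≤ countBelow c (labelList M)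
  pointwise-≥⇒countBelow-≤ c (lnode a≥b ps) = +-mono-≤ (isBelow-antitone c a≥b) (pointwiseL-≥⇒countBelow-≤ c ps)

  pointwiseL-≥⇒countBelow-≤ : ∀ c {ls ms} → PointwiseL _≥_ ls ms → countBelow c (labelListL ls) ≤ countBelow c (labelListL ms)
  pointwiseL-≥⇒countBelow-≤ c []                       = z≤n
  pointwiseL-≥⇒countBelow-≤ c (_∷_ {l} {m} {ls} {ms} p ps) =
    subst₂ _≤_ (sym (countBelow-++ c (labelList l) (labelListL ls))) (sym (countBelow-++ c (labelList m) (labelListL ms)))
      (+-mono-≤ (pointwise-≥⇒countBelow-≤ c p) (pointwiseL-≥⇒countBelow-≤ c ps))

-- As L ≥ M label-wise, L has at most as many labels below c as M; equality forces this vertex by vertex.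
mutual
  countBelow-≤⇒belowWhenever : ∀ c {L M} → Pointwise _≥_ L M → countBelow c (labelList M) ≤ countBelow c (labelList L) →
    Pointwise (BelowWhenever c) L M
  countBelow-≤⇒belowWhenever c (lnode {a} {b} a≥b ps) ≤
    with +-≤-tight (isBelow-antitone c a≥b) (pointwiseL-≥⇒countBelow-≤ c ps) ≤
  ... | ≤₁ , ≤₂ = lnode (λ b<c → isBelow-pos a c (≤-trans (≤-reflexive (sym (isBelow-< b<c))) ≤₁))
                        (countBelowL-≤⇒belowWhenever c ps ≤₂)

  countBelowL-≤⇒belowWhenever : ∀ c {ls ms} → PointwiseL _≥_ ls ms →
    countBelow c (labelListL ms) ≤ countBelow c (labelListL ls) →
    PointwiseL (BelowWhenever c) ls ms
  countBelowL-≤⇒belowWhenever c [] _ = []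
  countBelowL-≤⇒belowWhenever c (_∷_ {l} {m} {ls} {ms} p ps) ≤
    with +-≤-tight (pointwise-≥⇒countBelow-≤ c p) (pointwiseL-≥⇒countBelow-≤ c ps)
           (subst₂ _≤_ (countBelow-++ c (labelList m) (labelListL ms)) (countBelow-++ c (labelList l) (labelListL ls)) ≤)
  ... | ≤₁ , ≤₂ = countBelow-≤⇒belowWhenever c p ≤₁ ∷ countBelowL-≤⇒belowWhenever c ps ≤₂

mutual
  belowWhenever⇒countBelow-≤ : ∀ c {L M} → Pointwise (BelowWhenever c) L M →
    countBelow c (labelList M) ≤ countBelow c (labelList L)
  belowWhenever⇒countBelow-≤ c (lnode {a} {b} r ps) = +-mono-≤ root (belowWheneverL⇒countBelow-≤ c ps)
    where
    root : isBelow b c ≤ isBelow a c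
    root with b <? c
    ... | yes b<c = ≤-reflexive (trans (isBelow-< b<c) (sym (isBelow-< (r b<c))))
    ... | no  b≮c = subst (_≤ isBelow a c) (sym (isBelow-≥ (≮⇒≥ b≮c))) z≤n

  belowWheneverL⇒countBelow-≤ : ∀ c {ls ms} → PointwiseL (BelowWhenever c) ls ms →
    countBelow c (labelListL ms) ≤ countBelow c (labelListL ls)
  belowWheneverL⇒countBelow-≤ c [] = z≤n
  belowWheneverL⇒countBelow-≤ c (_∷_ {l} {m} {ls} {ms} p ps) =
    subst₂ _≤_ (sym (countBelow-++ c (labelList m) (labelListL ms))) (sym (countBelow-++ c (labelList l) (labelListL ls)))
      (+-mono-≤ (belowWhenever⇒countBelow-≤ c p) (belowWheneverL⇒countBelow-≤ c ps))

pointwise-≥⇒≤ₗ : ∀ {L M} → Pointwise _≥_ L M → exponents (labelList L) ≤ₗ exponents (labelList M)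
pointwise-≥⇒≤ₗ {L} {M} p = partialSum-≤⇒≤ₗ _ (exponents-equalFrom (labelList L) (labelList M))
  (λ c → subst₂ _≤_ (sym (partialSum-exponents (labelList L) c)) (sym (partialSum-exponents (labelList M) c))
                    (pointwise-≥⇒countBelow-≤ c p))

mutual
  increasing⇒≥byDepth : ∀ {b x L} → IncFrom b L → x ≤ suc b → Pointwise _≥_ L (byDepth x (shape L))
  increasing⇒≥byDepth (inc b<a as) x≤ = lnode (≤-trans x≤ b<a) (increasingL⇒≥byDepth as (s≤s (≤-trans x≤ b<a)))

  increasingL⇒≥byDepth : ∀ {a y ls} → All (IncFrom a) ls → y ≤ suc a → PointwiseL _≥_ ls (byDepthL y (shapeL ls))
  increasingL⇒≥byDepth []       _  = []
  increasingL⇒≥byDepth (i ∷ is) y≤ = increasing⇒≥byDepth i y≤ ∷ increasingL⇒≥byDepth is y≤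

mutual
  belowWhenever-byDepth : ∀ {c y} L → c ≤ y → Pointwise (BelowWhenever c) L (byDepth y (shape L))
  belowWhenever-byDepth (lnode a ls) c≤y =
    lnode (λ y<c → ⊥-elim (<-irrefl refl (<-≤-trans y<c c≤y))) (belowWheneverL-byDepthL ls (m≤n⇒m≤1+n c≤y))

  belowWheneverL-byDepthL : ∀ {c y} ls → c ≤ y → PointwiseL (BelowWhenever c) ls (byDepthL y (shapeL ls))
  belowWheneverL-byDepthL []       _   = []
  belowWheneverL-byDepthL (l ∷ ls) c≤y = belowWhenever-byDepth l c≤y ∷ belowWheneverL-byDepthL ls c≤y

-- excessChoice x d L : the vertices at coheight d whose label differs from x + d,
-- the label they get from byDepth x.
mutual
  excessChoice : ℕ → ∀ d L → Choice d (shape L)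
  excessChoice x zero (lnode a ls) with a ≟ x
  ... | yes _ = leaf false
  ... | no  _ = leaf true
  excessChoice x (suc d) (lnode a ls) = below (excessChoiceL (suc x) d ls)

  excessChoiceL : ℕ → ∀ d ls → Choices d (shapeL ls)
  excessChoiceL x d []       = []
  excessChoiceL x d (l ∷ ls) = excessChoice x d l ∷ excessChoiceL x d ls

mutual
  increasing⇒≥excessRaise : ∀ {b x} d {L} → IncFrom b L → x ≤ suc b → Pointwise _≥_ L (raise x (excessChoice x d L))
  increasing⇒≥excessRaise {x = x} zero {lnode a ls} i@(inc b<a as) x≤ with a ≟ x
  ... | yes refl = increasing⇒≥byDepth i x≤
  ... | no  a≢x  = lnode x<a (increasingL⇒≥byDepth as (s≤s x<a))
    where
    x<a : x < a
    x<a = ≤∧≢⇒< (≤-trans x≤ b<a) (a≢x ∘ sym)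
  increasing⇒≥excessRaise (suc d) {lnode a ls} (inc b<a as) x≤ =
    lnode (≤-trans x≤ b<a) (increasingL⇒≥excessRaiseL d as (s≤s (≤-trans x≤ b<a)))

  increasingL⇒≥excessRaiseL : ∀ {a y} d {ls} → All (IncFrom a) ls → y ≤ suc a →
    PointwiseL _≥_ ls (raiseL y (excessChoiceL y d ls))
  increasingL⇒≥excessRaiseL d []       _  = []
  increasingL⇒≥excessRaiseL d (i ∷ is) y≤ = increasing⇒≥excessRaise d i y≤ ∷ increasingL⇒≥excessRaiseL d is y≤

mutual
  belowWhenever-excessRaise : ∀ x d L → Pointwise (BelowWhenever (x + d)) L (byDepth x (shape L)) →
    Pointwise (BelowWhenever (suc (x + d))) L (raise x (excessChoice x d L))
  belowWhenever-excessRaise x zero (lnode a ls) _ with a ≟ x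
  ... | yes refl =
    lnode (λ _ → s≤s (≤-reflexive (sym (+-identityʳ a)))) (belowWheneverL-byDepthL ls (s≤s (≤-reflexive (+-identityʳ a))))
  ... | no  _    = belowWhenever-byDepth (lnode a ls) (s≤s (≤-reflexive (+-identityʳ x)))
  belowWhenever-excessRaise x (suc d) (lnode a ls) (lnode r ps) =
    lnode (λ _ → m<n⇒m<1+n (r (subst (x <_) (sym (+-suc x d)) (s≤s (m≤m+n x d)))))
      (subst (λ n → PointwiseL (BelowWhenever (suc n)) ls (raiseL (suc x) (excessChoiceL (suc x) d ls))) (sym (+-suc x d))
        (belowWheneverL-excessRaiseL (suc x) d ls
          (subst (λ n → PointwiseL (BelowWhenever n) ls (byDepthL (suc x) (shapeL ls))) (+-suc x d) ps)))

  belowWheneverL-excessRaiseL : ∀ x d ls → PointwiseL (BelowWhenever (x + d)) ls (byDepthL x (shapeL ls)) →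
    PointwiseL (BelowWhenever (suc (x + d))) ls (raiseL x (excessChoiceL x d ls))
  belowWheneverL-excessRaiseL x d []       _        = []
  belowWheneverL-excessRaiseL x d (l ∷ ls) (p ∷ ps) = belowWhenever-excessRaise x d l p ∷ belowWheneverL-excessRaiseL x d ls ps

colMon-≤ₗ-depthMonomial : ∀ {T} (f : IncColoring T) → colMon f ≤ₗ depthMonomial T
colMon-≤ₗ-depthMonomial (coloring L refl incr) =
  ≤ₗ-resp-≗ (λ i → sym (cnt≡exponents i L)) (λ i → cong (λ xs → exponents xs i) (labelList-byDepth 1 (shape L)))
    (pointwise-≥⇒≤ₗ (increasing⇒≥byDepth incr (s≤s z≤n)))

-- raise 1 (excessChoice 1 d L) lies label-wise below L, so its monomial lex-dominates that of L.
-- As L matches the depth monomial up to index d, the two colorings have equally many labels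
-- below d + 2, which forces exactly k excess vertices.
colMon-≤ₗ-raisedMonomial : ∀ {T} (f : IncColoring T) d k → (∀ i → i ≤ d → colMon f i ≡ depthMonomial T i) →
  colMon f (suc d) + k ≡ depthMonomial T (suc d) → ∃ λ (c : Choice d T) → #chosen c ≡ k × colMon f ≤ₗ raisedMonomial c
colMon-≤ₗ-raisedMonomial (coloring L refl incr) d k low top =
  excess , #excess≡k , ≤ₗ-resp-≗ (λ i → sym (cnt≡exponents i L)) (λ _ → refl) (pointwise-≥⇒≤ₗ L≥raise)
  where
  T : Tree
  T = shape L
  excess : Choice d T
  excess = excessChoice 1 d L
  ℓ : Monomial
  ℓ = exponents (labelList L)
  L≥byDepth : Pointwise _≥_ L (byDepth 1 T)
  L≥byDepth = increasing⇒≥byDepth incr (s≤s z≤n)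
  L≥raise : Pointwise _≥_ L (raise 1 excess)
  L≥raise = increasing⇒≥excessRaise d incr (s≤s z≤n)
  ℓ-low : ∀ i → i < suc d → ℓ i ≡ raisedMonomial excess i
  ℓ-low i i≤d =
    trans (sym (cnt≡exponents i L)) (trans (low i (s≤s⁻¹ i≤d)) (sym (raisedMonomial-below excess i (s≤s⁻¹ i≤d))))
  byDepth-countBelow : countBelow (suc d) (labelList (byDepth 1 T)) ≡ countBelow (suc d) (labelList L)
  byDepth-countBelow = begin
    countBelow (suc d) (labelList (byDepth 1 T))
      ≡⟨ partialSum-exponents (labelList (byDepth 1 T)) (suc d) ⟨
    partialSum (exponents (labelList (byDepth 1 T))) (suc d)
      ≡⟨ cong (λ xs → partialSum (exponents xs) (suc d)) (labelList-byDepth 1 T) ⟩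
    partialSum (depthMonomial T) (suc d)
      ≡⟨ partialSum-cong (suc d) (λ i i≤d → trans (sym (raisedMonomial-below excess i (s≤s⁻¹ i≤d))) (sym (ℓ-low i i≤d))) ⟩
    partialSum ℓ (suc d)
      ≡⟨ partialSum-exponents (labelList L) (suc d) ⟩
    countBelow (suc d) (labelList L) ∎
    where open ≡-Reasoning
  L⊑raise : Pointwise (BelowWhenever (suc (suc d))) L (raise 1 excess)
  L⊑raise = belowWhenever-excessRaise 1 d L (countBelow-≤⇒belowWhenever (suc d) L≥byDepth (≤-reflexive byDepth-countBelow))
  partialSum-agree : partialSum ℓ (suc (suc d)) ≡ partialSum (raisedMonomial excess) (suc (suc d))
  partialSum-agree = trans (partialSum-exponents (labelList L) _) (trans
    (≤-antisym (pointwise-≥⇒countBelow-≤ _ L≥raise) (belowWhenever⇒countBelow-≤ _ L⊑raise))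
    (sym (partialSum-exponents (labelList (raise 1 excess)) _)))
  top-agree : ℓ (suc d) ≡ raisedMonomial excess (suc d)
  top-agree = +-cancelˡ-≡ (partialSum ℓ (suc d)) _ _
    (trans partialSum-agree (cong (_+ raisedMonomial excess (suc d)) (sym (partialSum-cong (suc d) ℓ-low))))
  #excess≡k : #chosen excess ≡ k
  #excess≡k = +-cancelˡ-≡ (raisedMonomial excess (suc d)) _ _ (trans (raisedMonomial-top excess)
    (trans (sym top) (cong (_+ k) (trans (cnt≡exponents (suc d) L) top-agree))))

samplesTo-unique : ∀ {T n e m m'} → SamplesTo T n e m → SamplesTo T n e m' → m ≗ m'
samplesTo-unique (inΓ , pre , max) (inΓ' , pre' , max') = ≤ₗ-antisym (max' _ inΓ pre) (max _ inΓ' pre')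

samplesTo-prefix-cong : ∀ {T n e e' m} → (∀ i → i ≤ n → e i ≡ e' i) → SamplesTo T n e m → SamplesTo T n e' m
samplesTo-prefix-cong e≡e' (inΓ , pre , max) =
  inΓ , (λ i i≤n → trans (pre i i≤n) (e≡e' i i≤n)) ,
  λ m' inΓ' pre' → max m' inΓ' (λ i i≤n → trans (pre' i i≤n) (sym (e≡e' i i≤n)))

samples-depthMonomial : ∀ T → SamplesTo T 0 (λ _ → 0) (depthMonomial T)
samples-depthMonomial T = (byDepthColoring T , byDepthColoring-monomial T) , (λ { zero _ → depths-below 1 T z<s }) ,
  λ m' (f , f≗m') _ → ≤ₗ-resp-≗ f≗m' (λ _ → refl) (colMon-≤ₗ-depthMonomial f)

record MinChoice {d T} (k : ℕ) (c : Choice d T) : Set where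
  constructor minChoice
  field
    #chosen≡ : #chosen c ≡ k
    minimal  : ∀ {S} → SubSum k (level 0 d T) S → chosenDepths 0 c ⪯ S

minChoice-exists : ∀ T d k → k ≤ length (level 0 d T) → ∃ λ (c : Choice d T) → MinChoice k c
minChoice-exists T d k k≤ with minSubSum-exists k (level 0 d T) k≤
... | _ , s , min with subSum⇒choice 0 d T s
... | c , refl , refl = c , minChoice refl min

minChoice⇒minSubSum : ∀ {d T k} {c : Choice d T} → MinChoice k c → MinSubSum k (level 0 d T) (chosenDepths 0 c)
minChoice⇒minSubSum {c = c} (minChoice refl min) = choice⇒subSum 0 c , min

samples-raisedMonomial : ∀ {d T k} {c : Choice d T} → MinChoice k c → SamplesTo T (suc d) (raisedMonomial c) (raisedMonomial c)
samples-raisedMonomial {d} {T} {k} {c} (minChoice refl min) =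
  (raisedColoring c , λ i → cnt≡exponents i (raise 1 c)) , (λ _ _ → refl) , maximal
  where
  maximal : ∀ m → InGamma T m → Prefix (suc d) (raisedMonomial c) m → m ≤ₗ raisedMonomial c
  maximal m (f , f≗m) pre with colMon-≤ₗ-raisedMonomial f d k
      (λ i i≤d → trans (f≗m i) (trans (pre i (m≤n⇒m≤1+n i≤d)) (raisedMonomial-below c i i≤d)))
      (trans (cong (_+ k) (trans (f≗m (suc d)) (pre (suc d) ≤-refl))) (raisedMonomial-top c))
  ... | c' , #c'≡k , f≤c' = ≤ₗ-resp-≗ f≗m (λ _ → refl) (≤ₗ-trans f≤c'
    (raised-antitone (raised-choice c) (raised-choice c')
      (exponents-≤ₗ (min (subst (λ n → SubSum n (level 0 d T) (chosenDepths 0 c')) #c'≡k (choice⇒subSum 0 c'))))))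

module _ {T T' : Tree} (same : SameSampling T T') where

  sameSampling⇒depthMonomial : depthMonomial T ≗ depthMonomial T'
  sameSampling⇒depthMonomial = samplesTo-unique (Equivalence.to (same 0 _ _) (samples-depthMonomial T)) (samples-depthMonomial T')

  sameSampling⇒minChoice-↭ : ∀ {d k} {c : Choice d T} {c' : Choice d T'} → MinChoice k c → MinChoice k c' →
    chosenDepths 0 c ↭ chosenDepths 0 c'
  sameSampling⇒minChoice-↭ {d} {k} {c} {c'} mc@(minChoice refl _) mc'@(minChoice #c'≡k _) =
    exponents-injective _ _ (raised-injective (raised-choice c) (raised-choice c') raised≗ sameSampling⇒depthMonomial)
    where
    prefix≡ : ∀ i → i ≤ suc d → raisedMonomial c' i ≡ raisedMonomial c i
    prefix≡ i i≤ with m≤n⇒m<n∨m≡n i≤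
    ... | inj₁ i≤d = trans (raisedMonomial-below c' i (s≤s⁻¹ i≤d))
                     (trans (sym (sameSampling⇒depthMonomial i)) (sym (raisedMonomial-below c i (s≤s⁻¹ i≤d))))
    ... | inj₂ refl = +-cancelʳ-≡ k _ _ (trans (subst (λ n → raisedMonomial c' (suc d) + n ≡ _) #c'≡k (raisedMonomial-top c'))
                     (trans (sym (sameSampling⇒depthMonomial (suc d))) (sym (raisedMonomial-top c))))
    raised≗ : raisedMonomial c ≗ raisedMonomial c'
    raised≗ = samplesTo-unique (Equivalence.to (same (suc d) _ _) (samples-raisedMonomial mc))
                               (samplesTo-prefix-cong prefix≡ (samples-raisedMonomial mc'))

  sameSampling⇒level-≋ : ∀ d → level 0 d T ≋ level 0 d T'
  sameSampling⇒level-≋ d = ≋-fromMinSubSums _ refl (sym ∣level∣) sameMin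
    where
    ∣level∣ : length (level 0 d T) ≡ length (level 0 d T')
    ∣level∣ = trans (sym (depthMonomial-level T d)) (trans (sameSampling⇒depthMonomial (suc d)) (depthMonomial-level T' d))
    sameMin : SameMinSubSums (level 0 d T) (level 0 d T')
    sameMin k k≤ with minChoice-exists T d k k≤ | minChoice-exists T' d k (subst (k ≤_) ∣level∣ k≤)
    ... | c , mc | c' , mc' = _ , _ , minChoice⇒minSubSum mc , minChoice⇒minSubSum mc' , sameSampling⇒minChoice-↭ mc mc'

concatUpTo : ∀ {A : Set} → (ℕ → List A) → ℕ → List A
concatUpTo f zero    = []
concatUpTo f (suc n) = concatUpTo f n ++ f n

concatUpTo-suc : ∀ {A : Set} (f : ℕ → List A) n → concatUpTo f (suc n) ≡ f 0 ++ concatUpTo (f ∘ suc) n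
concatUpTo-suc f zero    = sym (++-identityʳ (f 0))
concatUpTo-suc f (suc n) = trans (cong (_++ f (suc n)) (concatUpTo-suc f n)) (++-assoc (f 0) _ _)

concatUpTo-[] : ∀ {A : Set} n → concatUpTo {A} (λ _ → []) n ≡ []
concatUpTo-[] zero    = refl
concatUpTo-[] (suc n) = trans (++-identityʳ _) (concatUpTo-[] n)

concatUpTo-++ : ∀ {A : Set} (f g : ℕ → List A) n → concatUpTo (λ i → f i ++ g i) n ↭ concatUpTo f n ++ concatUpTo g n
concatUpTo-++ f g zero    = ↭-refl
concatUpTo-++ f g (suc n) =
  ↭-trans (↭.++⁺ʳ (f n ++ g n) (concatUpTo-++ f g n)) (↭-interchange (concatUpTo f n) (concatUpTo g n) (f n) (g n))

concatUpTo-≋ : ∀ {f g : ℕ → List (List ℕ)} → (∀ i → f i ≋ g i) → ∀ n → concatUpTo f n ≋ concatUpTo g n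
concatUpTo-≋ f≋g zero    = MonPerm.↭-refl
concatUpTo-≋ f≋g (suc n) = ≋.++⁺ (concatUpTo-≋ f≋g n) (f≋g n)

mutual
  size : Tree → ℕ
  size (node ts) = suc (sizeL ts)

  sizeL : List Tree → ℕ
  sizeL []       = 0
  sizeL (t ∷ ts) = size t + sizeL ts

mutual
  profiles-by-level : ∀ a t n → size t ≤ n → profiles a t ↭ concatUpTo (λ d → level a d t) n
  profiles-by-level a (node ts) (suc n) (s≤s ∣ts∣≤n) =
    ↭-trans (Perm.prep (depths a (node ts)) (profilesL-by-level (suc a) ts n ∣ts∣≤n))
            (↭-reflexive (sym (concatUpTo-suc (λ d → level a d (node ts)) n)))

  profilesL-by-level : ∀ a ts n → sizeL ts ≤ n → profilesL a ts ↭ concatUpTo (λ d → levelL a d ts) n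
  profilesL-by-level a []       n _ = ↭-reflexive (sym (concatUpTo-[] n))
  profilesL-by-level a (t ∷ ts) n ≤n =
    ↭-trans (↭.++⁺ (profiles-by-level a t n (≤-trans (m≤m+n (size t) (sizeL ts)) ≤n))
                    (profilesL-by-level a ts n (≤-trans (m≤n+m (sizeL ts) (size t)) ≤n)))
            (↭-sym (concatUpTo-++ (λ d → level a d t) (λ d → levelL a d ts) n))

↭⇒≋ : ∀ {X Y} → X ↭ Y → X ≋ Y
↭⇒≋ = Perm.↭⇒↭ₛ′ Perm.↭-isEquivalence

theorem5p6 : (T T' : Tree) → SameSampling T T' → profileProfile T ≋ profileProfile T'
theorem5p6 T T' same = begin
  profiles 0 T                         ↭⟨ ↭⇒≋ (profiles-by-level 0 T n (m≤m+n (size T) (size T'))) ⟩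
  concatUpTo (λ d → level 0 d T) n     ↭⟨ concatUpTo-≋ (sameSampling⇒level-≋ same) n ⟩
  concatUpTo (λ d → level 0 d T') n    ↭⟨ ↭⇒≋ (profiles-by-level 0 T' n (m≤n+m (size T') (size T))) ⟨
  profiles 0 T'                        ∎
  where
  open MonPerm.PermutationReasoning
  n : ℕ
  n = size T + size T'
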